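{- Let $d,k,n$ be positive integers with $1\leq d\leq \lfloor n/2\rfloor$ and $2\leq k\leq \lfloor n/2\rfloor+1$, and let $C_n$ be the cycle with vertex set $\{0,\ldots,n-1\}$ and edges $\{i,(i+1)\bmod n\}$ for $0\le i\le n-1$. Then \[\mathrm{gp}^k_d(C_n)=\begin{cases} n & \text{if } 1\leq d\leq k-2,\\ \left\lfloor\frac{(k-1)n}{d+1}\right\rfloor & \text{if } k-1\leq d\leq \lfloor n/2\rfloor.\end{cases}\]
   Context: For a graph $G$, a geodesic of $G$ is a shortest path between two vertices of $G$; its length $\lambda(g)$ is its number of edges and $V(g)$ is its vertex set. For integers $d\ge1$, $k\ge2$, a set $S\subseteq V(G)$ is a $k$-general $d$-position set in $G$ if for every geodesic $g$ of $G$, $|S\cap V(g)|\geq k$ implies $\lambda(g)>d$. The $k$-general $d$-position number $\mathrm{gp}^k_d(G)$ is the largest cardinality of a $k$-general $d$-position set in $G$. -}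

module Defs where

open import Data.Nat using (ℕ; zero; suc; _+_; _≤_; _<_; NonZero)
open import Data.Nat.DivMod using (_%_)
open import Data.Fin using (Fin; toℕ)
open import Data.Fin.Subset using (Subset; ⁅_⁆; _∪_; _∩_; ∣_∣)
open import Data.Product using (Σ; _×_)
open import Data.Sum using (_⊎_)
open import Relation.Binary.PropositionalEquality using (_≡_)

Graph : ℕ → Set₁
Graph n = Fin n → Fin n → Set

CycleAdj : (n : ℕ) → .{{NonZero n}} → Graph n
CycleAdj n i j = (toℕ j ≡ (toℕ i + 1) % n) ⊎ (toℕ i ≡ (toℕ j + 1) % n)

data Walk {n : ℕ} (G : Graph n) : Fin n → Fin n → Set where
  [_]   : (v : Fin n) → Walk G v v
  _∷⟨_⟩_ : (u : Fin n) {v w : Fin n} → G u v → Walk G v w → Walk G u w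

module _ {n : ℕ} {G : Graph n} where
  len : {u v : Fin n} → Walk G u v → ℕ
  len [ v ] = zero
  len (u ∷⟨ _ ⟩ w) = suc (len w)

  verts : {u v : Fin n} → Walk G u v → Subset n
  verts [ v ] = ⁅ v ⁆
  verts (u ∷⟨ _ ⟩ w) = ⁅ u ⁆ ∪ verts w

IsGeodesic : {n : ℕ} (G : Graph n) {u v : Fin n} → Walk G u v → Set
IsGeodesic G {u} {v} g = (h : Walk G u v) → len g ≤ len h

IsKGenDPos : {n : ℕ} (G : Graph n) (k d : ℕ) → Subset n → Set
IsKGenDPos {n} G k d S =
  (u v : Fin n) (g : Walk G u v) → IsGeodesic G g → k ≤ ∣ S ∩ verts g ∣ → d < len g

IsGpNumber : {n : ℕ} (G : Graph n) (k d m : ℕ) → Set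
IsGpNumber {n} G k d m =
  Σ (Subset n) (λ S → IsKGenDPos G k d S × ∣ S ∣ ≡ m)
  × ((S : Subset n) → IsKGenDPos G k d S → ∣ S ∣ ≤ m)

module Submission where

-- The map x ↦ x mod n from ℕ onto the vertices of Cₙ is a covering: a walk with L
-- edges lifts to a walk in ℕ sweeping an interval of length at most L, so its
-- vertices lie on an arc of at most L + 1 consecutive vertices, and for 2d ≤ n the
-- arcs with d edges are geodesics.
-- Upper bound: an arc of d + 1 vertices meets a k-general d-position set S in at
-- most k - 1 vertices, and each vertex lies on exactly d + 1 of the n such arcs,
-- so (d + 1)|S| ≤ (k - 1)n.
-- Lower bound: for m = ⌊(k - 1)n/(d + 1)⌋ the vertices i with ⌊im/n⌋ < ⌊(i + 1)m/n⌋
-- form a set of size m meeting an arc of w ≤ d + 1 consecutive vertices from b on in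
-- ⌊(b + w)m/n⌋ - ⌊bm/n⌋ ≤ k - 1 vertices.
-- For d ≤ k - 2 the whole vertex set works: a walk with at most d edges has at most
-- d + 1 < k vertices.

open import Data.Nat.Base
open import Data.Nat.Properties
open import Data.Nat.DivMod
open import Data.Nat.Divisibility using (n∣m*n; ∣-refl)
open import Algebra.Properties.CommutativeMonoid.Sum +-0-commutativeMonoid
  using (sum-syntax; sum-cong-≗; ∑-comm)
open import Data.Bool.Base using (Bool; true)
open import Data.Bool.Properties using (T-≡)
open import Data.Empty using (⊥-elim)
open import Data.Fin.Base using (Fin; zero; suc; toℕ; fromℕ<)
open import Data.Fin.Properties using (toℕ-fromℕ<; toℕ-injective; toℕ<n)
open import Data.Fin.Subset using (Subset; ⁅_⁆; _∪_; _∩_; ∣_∣; ⊤; ⊥; _∈_; _∉_; _⊆_; inside; outside)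
open import Data.Fin.Subset.Properties
open import Data.Product using (∃-syntax; _×_; _,_; proj₂)
open import Data.Sum using (inj₁; inj₂)
open import Data.Vec.Base using ([]; _∷_; tabulate; here; there)
open import Data.Vec.Properties using (lookup∘tabulate; lookup⇒[]=; []=⇒lookup)
open import Function.Base using (_∘_)
open import Function.Bundles using (Equivalence)
open import Relation.Binary.PropositionalEquality
open import Relation.Nullary using (¬_; yes; no)
open import Defs

∣p∪q∣≤∣p∣+∣q∣ : ∀ {n} (p q : Subset n) → ∣ p ∪ q ∣ ≤ ∣ p ∣ + ∣ q ∣
∣p∪q∣≤∣p∣+∣q∣ [] [] = z≤n
∣p∪q∣≤∣p∣+∣q∣ (inside ∷ p) (s ∷ q) =
  s≤s (≤-trans (∣p∪q∣≤∣p∣+∣q∣ p q) (+-monoʳ-≤ ∣ p ∣ (∣p∣≤∣x∷p∣ s q)))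
∣p∪q∣≤∣p∣+∣q∣ (outside ∷ p) (inside ∷ q) =
  ≤-trans (s≤s (∣p∪q∣≤∣p∣+∣q∣ p q)) (≤-reflexive (sym (+-suc ∣ p ∣ ∣ q ∣)))
∣p∪q∣≤∣p∣+∣q∣ (outside ∷ p) (outside ∷ q) = ∣p∪q∣≤∣p∣+∣q∣ p q

∷-disjoint⁻ : ∀ {n s t} {p q : Subset n} → (∀ {x} → x ∈ s ∷ p → x ∉ t ∷ q) → ∀ {x} → x ∈ p → x ∉ q
∷-disjoint⁻ disjoint x∈p x∈q = disjoint (there x∈p) (there x∈q)

∣p∪q∣≡∣p∣+∣q∣ : ∀ {n} (p q : Subset n) → (∀ {x} → x ∈ p → x ∉ q) → ∣ p ∪ q ∣ ≡ ∣ p ∣ + ∣ q ∣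
∣p∪q∣≡∣p∣+∣q∣ [] [] _ = refl
∣p∪q∣≡∣p∣+∣q∣ (inside ∷ p) (inside ∷ q) disjoint = ⊥-elim (disjoint here here)
∣p∪q∣≡∣p∣+∣q∣ (inside ∷ p) (outside ∷ q) disjoint =
  cong suc (∣p∪q∣≡∣p∣+∣q∣ p q (∷-disjoint⁻ disjoint))
∣p∪q∣≡∣p∣+∣q∣ (outside ∷ p) (inside ∷ q) disjoint =
  trans (cong suc (∣p∪q∣≡∣p∣+∣q∣ p q (∷-disjoint⁻ disjoint))) (sym (+-suc ∣ p ∣ ∣ q ∣))
∣p∪q∣≡∣p∣+∣q∣ (outside ∷ p) (outside ∷ q) disjoint = ∣p∪q∣≡∣p∣+∣q∣ p q (∷-disjoint⁻ disjoint)

∣r∩[⁅x⁆∪q]∣≡∣r∩⁅x⁆∣+∣r∩q∣ : ∀ {n} (r q : Subset n) {x} → x ∉ q →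
                            ∣ r ∩ (⁅ x ⁆ ∪ q) ∣ ≡ ∣ r ∩ ⁅ x ⁆ ∣ + ∣ r ∩ q ∣
∣r∩[⁅x⁆∪q]∣≡∣r∩⁅x⁆∣+∣r∩q∣ r q {x} x∉q =
  trans (cong ∣_∣ (∩-distribˡ-∪ r ⁅ x ⁆ q)) (∣p∪q∣≡∣p∣+∣q∣ (r ∩ ⁅ x ⁆) (r ∩ q) disjoint)
  where
  disjoint : ∀ {y} → y ∈ r ∩ ⁅ x ⁆ → y ∉ r ∩ q
  disjoint y∈r∩⁅x⁆ y∈r∩q =
    x∉q (subst (_∈ q) (x∈⁅y⁆⇒x≡y x (proj₂ (x∈p∩q⁻ r ⁅ x ⁆ y∈r∩⁅x⁆))) (proj₂ (x∈p∩q⁻ r q y∈r∩q)))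

x∈p⇒∣p∩⁅x⁆∣≡1 : ∀ {n} {p : Subset n} {x} → x ∈ p → ∣ p ∩ ⁅ x ⁆ ∣ ≡ 1
x∈p⇒∣p∩⁅x⁆∣≡1 {p = p} {x} x∈p = trans (cong ∣_∣ p∩⁅x⁆≡⁅x⁆) (∣⁅x⁆∣≡1 x)
  where
  p∩⁅x⁆≡⁅x⁆ : p ∩ ⁅ x ⁆ ≡ ⁅ x ⁆
  p∩⁅x⁆≡⁅x⁆ = ⊆-antisym (p∩q⊆q p ⁅ x ⁆)
    λ y∈⁅x⁆ → x∈p∩q⁺ (subst (_∈ p) (sym (x∈⁅y⁆⇒x≡y x y∈⁅x⁆)) x∈p , y∈⁅x⁆)

x∉p⇒∣p∩⁅x⁆∣≡0 : ∀ {n} {p : Subset n} {x} → x ∉ p → ∣ p ∩ ⁅ x ⁆ ∣ ≡ 0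
x∉p⇒∣p∩⁅x⁆∣≡0 {n} {p} {x} x∉p = n≤0⇒n≡0 (≤-trans (p⊆q⇒∣p∣≤∣q∣ p∩⁅x⁆⊆⊥) (≤-reflexive (∣⊥∣≡0 n)))
  where
  p∩⁅x⁆⊆⊥ : p ∩ ⁅ x ⁆ ⊆ ⊥
  p∩⁅x⁆⊆⊥ y∈ with x∈p∩q⁻ p ⁅ x ⁆ y∈
  ... | y∈p , y∈⁅x⁆ = ⊥-elim (x∉p (subst (_∈ p) (x∈⁅y⁆⇒x≡y x y∈⁅x⁆) y∈p))

∈-tabulate⁺ : ∀ {n} {f : Fin n → Bool} {i} → f i ≡ true → i ∈ tabulate f
∈-tabulate⁺ {f = f} {i} fi≡true = lookup⇒[]= i (tabulate f) (trans (lookup∘tabulate f i) fi≡true)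

∈-tabulate⁻ : ∀ {n} {f : Fin n → Bool} {i} → i ∈ tabulate f → f i ≡ true
∈-tabulate⁻ {f = f} {i} i∈ = trans (sym (lookup∘tabulate f i)) ([]=⇒lookup i∈)

∑-replicate : ∀ m c → ∑[ i < m ] c ≡ m * c
∑-replicate zero c = refl
∑-replicate (suc m) c = cong (c +_) (∑-replicate m c)

∑-≤-* : ∀ m (f : Fin m → ℕ) {c} → (∀ i → f i ≤ c) → ∑[ i < m ] f i ≤ m * c
∑-≤-* zero f _ = z≤n
∑-≤-* (suc m) f f≤c = +-mono-≤ (f≤c zero) (∑-≤-* m (f ∘ suc) (f≤c ∘ suc))

m*n≤o⇒m≤o/n : ∀ {m o} n .{{_ : NonZero n}} → m * n ≤ o → m ≤ o / n
m*n≤o⇒m≤o/n {m} n m*n≤o = subst (_≤ _ / n) (m*n/n≡m m n) (/-monoˡ-≤ n m*n≤o)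

module _ {n : ℕ} {G : Graph n} where

  source∈verts : ∀ {u v} (g : Walk G u v) → u ∈ verts g
  source∈verts [ v ] = x∈⁅x⁆ v
  source∈verts (u ∷⟨ _ ⟩ _) = x∈p∪q⁺ (inj₁ (x∈⁅x⁆ u))

  target∈verts : ∀ {u v} (g : Walk G u v) → v ∈ verts g
  target∈verts [ v ] = x∈⁅x⁆ v
  target∈verts (u ∷⟨ _ ⟩ g) = x∈p∪q⁺ (inj₂ (target∈verts g))

  ∣verts∣≤1+len : ∀ {u v} (g : Walk G u v) → ∣ verts g ∣ ≤ suc (len g)
  ∣verts∣≤1+len [ v ] = ≤-reflexive (∣⁅x⁆∣≡1 v)
  ∣verts∣≤1+len (u ∷⟨ _ ⟩ g) =
    ≤-trans (∣p∪q∣≤∣p∣+∣q∣ ⁅ u ⁆ (verts g))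
            (≤-trans (≤-reflexive (cong (_+ ∣ verts g ∣) (∣⁅x⁆∣≡1 u))) (s≤s (∣verts∣≤1+len g)))

⊤-isKGenDPos : ∀ {n} (G : Graph n) {k d} → d ≤ k → IsKGenDPos G (suc (suc k)) d ⊤
⊤-isKGenDPos G d≤k u v g _ k+2≤∣⊤∩g∣ =
  ≤-trans (s≤s d≤k)
    (s≤s⁻¹ (≤-trans k+2≤∣⊤∩g∣ (≤-trans (∣p∩q∣≤∣q∣ ⊤ (verts g)) (∣verts∣≤1+len g))))

⊤-isGpNumber : ∀ {n} (G : Graph n) {k d} → d ≤ k → IsGpNumber G (suc (suc k)) d n
⊤-isGpNumber {n} G d≤k = (⊤ , ⊤-isKGenDPos G d≤k , ∣⊤∣≡n n) , λ S _ → ∣p∣≤n S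

module Cycle (n : ℕ) .{{_ : NonZero n}} where

  Cₙ : Graph n
  Cₙ = CycleAdj n

  vertex : ℕ → Fin n
  vertex x = fromℕ< (m%n<n x n)

  toℕ-vertex : ∀ x → toℕ (vertex x) ≡ x % n
  toℕ-vertex x = toℕ-fromℕ< (m%n<n x n)

  vertex-toℕ : ∀ i → vertex (toℕ i) ≡ i
  vertex-toℕ i = toℕ-injective (trans (toℕ-vertex (toℕ i)) (m<n⇒m%n≡m (toℕ<n i)))

  vertex≡⇒%≡ : ∀ {x y} → vertex x ≡ vertex y → x % n ≡ y % n
  vertex≡⇒%≡ {x} {y} eq = trans (sym (toℕ-vertex x)) (trans (cong toℕ eq) (toℕ-vertex y))

  %≡⇒vertex≡ : ∀ {x y} → x % n ≡ y % n → vertex x ≡ vertex y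
  %≡⇒vertex≡ {x} {y} eq = toℕ-injective (trans (toℕ-vertex x) (trans eq (sym (toℕ-vertex y))))

  vertex-n+ : ∀ x → vertex (n + x) ≡ vertex x
  vertex-n+ x = %≡⇒vertex≡ (trans (cong (_% n) (+-comm n x)) ([m+n]%n≡m%n x n))

  vertex-*n+ : ∀ q x → vertex (q * n + x) ≡ vertex x
  vertex-*n+ q x = %≡⇒vertex≡ (trans (cong (_% n) (+-comm (q * n) x)) ([m+kn]%n≡m%n x q n))

  vertex-+-cong : ∀ k {x y} → vertex x ≡ vertex y → vertex (k + x) ≡ vertex (k + y)
  vertex-+-cong k {x} {y} eq = %≡⇒vertex≡ (begin
    (k + x) % n          ≡⟨ %-distribˡ-+ k x n ⟩
    (k % n + x % n) % n  ≡⟨ cong (λ r → (k % n + r) % n) (vertex≡⇒%≡ eq) ⟩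
    (k % n + y % n) % n  ≡⟨ %-distribˡ-+ k y n ⟨
    (k + y) % n          ∎)
    where open ≡-Reasoning

  vertex-suc-injective : ∀ {x y} → vertex (suc x) ≡ vertex (suc y) → vertex x ≡ vertex y
  vertex-suc-injective {x} {y} eq = begin
    vertex x                ≡⟨ vertex-n+ x ⟨
    vertex (n + x)          ≡⟨ cong vertex (pred-n+suc x) ⟨
    vertex (pred n + suc x) ≡⟨ vertex-+-cong (pred n) eq ⟩
    vertex (pred n + suc y) ≡⟨ cong vertex (pred-n+suc y) ⟩
    vertex (n + y)          ≡⟨ vertex-n+ y ⟩
    vertex y                ∎
    where
    open ≡-Reasoning
    pred-n+suc : ∀ z → pred n + suc z ≡ n + z
    pred-n+suc z = trans (+-suc (pred n) z) (cong (_+ z) (suc-pred n))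

  vertex≡⇒n+x≤y : ∀ {x y} → vertex x ≡ vertex y → x < y → n + x ≤ y
  vertex≡⇒n+x≤y {x} {y} eq x<y = begin
    n + x                  ≡⟨ cong (n +_) x≡ ⟩
    n + (r + x / n * n)    ≡⟨ +-assoc n r _ ⟨
    n + r + x / n * n      ≡⟨ cong (_+ x / n * n) (+-comm n r) ⟩
    r + n + x / n * n      ≡⟨ +-assoc r n _ ⟩
    r + suc (x / n) * n    ≤⟨ +-monoʳ-≤ r (*-monoˡ-≤ n x/n<y/n) ⟩
    r + y / n * n          ≡⟨ y≡ ⟨
    y                      ∎
    where
    open ≤-Reasoning
    r = x % n
    x≡ : x ≡ r + x / n * n
    x≡ = m≡m%n+[m/n]*n x n
    y≡ : y ≡ r + y / n * n
    y≡ = trans (m≡m%n+[m/n]*n y n) (cong (_+ y / n * n) (sym (vertex≡⇒%≡ eq)))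
    x/n<y/n : x / n < y / n
    x/n<y/n = *-cancelʳ-< n (x / n) (y / n) (+-cancelˡ-< r _ _ (subst₂ _<_ x≡ y≡ x<y))

  toℕ-vertex-suc : ∀ x → toℕ (vertex (suc x)) ≡ (toℕ (vertex x) + 1) % n
  toℕ-vertex-suc x = begin
    toℕ (vertex (suc x))       ≡⟨ toℕ-vertex (suc x) ⟩
    suc x % n                  ≡⟨ cong (_% n) (+-comm 1 x) ⟩
    (x + 1) % n                ≡⟨ %-distribˡ-+ x 1 n ⟩
    (x % n + 1 % n) % n        ≡⟨ cong (λ r → (r + 1 % n) % n) (m%n%n≡m%n x n) ⟨
    (x % n % n + 1 % n) % n    ≡⟨ %-distribˡ-+ (x % n) 1 n ⟨
    (x % n + 1) % n            ≡⟨ cong (λ r → (r + 1) % n) (toℕ-vertex x) ⟨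
    (toℕ (vertex x) + 1) % n   ∎
    where open ≡-Reasoning

  forward-target : ∀ {u v : Fin n} → toℕ v ≡ (toℕ u + 1) % n → v ≡ vertex (suc (toℕ u))
  forward-target {u} eq = toℕ-injective (trans eq (sym (begin
    toℕ (vertex (suc (toℕ u)))       ≡⟨ toℕ-vertex-suc (toℕ u) ⟩
    (toℕ (vertex (toℕ u)) + 1) % n   ≡⟨ cong (λ w → (toℕ w + 1) % n) (vertex-toℕ u) ⟩
    (toℕ u + 1) % n                  ∎)))
    where open ≡-Reasoning

  lift-forward : ∀ {u v p} → toℕ v ≡ (toℕ u + 1) % n → vertex p ≡ u → vertex (suc p) ≡ v
  lift-forward {u} eq p↦u =
    trans (vertex-+-cong 1 (trans p↦u (sym (vertex-toℕ u)))) (sym (forward-target eq))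

  lift-backward : ∀ {u v p} → toℕ u ≡ (toℕ v + 1) % n → vertex (suc p) ≡ u → vertex p ≡ v
  lift-backward {v = v} eq p+1↦u =
    trans (vertex-suc-injective (trans p+1↦u (forward-target eq))) (vertex-toℕ v)

  descent : (b w : ℕ) → Walk Cₙ (vertex (w + b)) (vertex b)
  descent b zero = [ vertex b ]
  descent b (suc w) = vertex (suc w + b) ∷⟨ inj₂ (toℕ-vertex-suc (w + b)) ⟩ descent b w

  len-descent : ∀ b w → len (descent b w) ≡ w
  len-descent b zero = refl
  len-descent b (suc w) = cong suc (len-descent b w)

  ∈-descent⁺ : ∀ {b w y} → b ≤ y → y ≤ w + b → vertex y ∈ verts (descent b w)
  ∈-descent⁺ {b} {zero} b≤y y≤b with ≤-antisym b≤y y≤b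
  ... | refl = x∈⁅x⁆ (vertex b)
  ∈-descent⁺ {b} {suc w} b≤y y≤1+w+b with m≤n⇒m<n∨m≡n y≤1+w+b
  ... | inj₂ refl = x∈p∪q⁺ (inj₁ (x∈⁅x⁆ _))
  ... | inj₁ y<1+w+b = x∈p∪q⁺ (inj₂ (∈-descent⁺ b≤y (s≤s⁻¹ y<1+w+b)))

  ∈-descent⁻ : ∀ {b w x} → x ∈ verts (descent b w) → ∃[ y ] b ≤ y × y ≤ w + b × vertex y ≡ x
  ∈-descent⁻ {b} {zero} x∈ = b , ≤-refl , ≤-refl , sym (x∈⁅y⁆⇒x≡y _ x∈)
  ∈-descent⁻ {b} {suc w} x∈ with x∈p∪q⁻ ⁅ vertex (suc w + b) ⁆ (verts (descent b w)) x∈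
  ... | inj₁ x∈top = suc w + b , m≤n+m b (suc w) , ≤-refl , sym (x∈⁅y⁆⇒x≡y _ x∈top)
  ... | inj₂ x∈rest with ∈-descent⁻ x∈rest
  ...   | y , b≤y , y≤w+b , y↦x = y , b≤y , m≤n⇒m≤1+n y≤w+b , y↦x

  top∉descent : ∀ {b w} → suc w < n → vertex (suc w + b) ∉ verts (descent b w)
  top∉descent {b} {w} 1+w<n top∈ with ∈-descent⁻ top∈
  ... | y , b≤y , y≤w+b , y↦top = <⇒≱ (begin-strict
      suc w + b  <⟨ +-monoˡ-< b 1+w<n ⟩
      n + b      ≤⟨ +-monoʳ-≤ n b≤y ⟩
      n + y      ∎) (vertex≡⇒n+x≤y y↦top (s≤s y≤w+b))
    where open ≤-Reasoning

  verts-descent≡⊤ : verts (descent 0 (pred n)) ≡ ⊤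
  verts-descent≡⊤ = ⊆-antisym ⊆⊤ λ {x} _ → subst (_∈ _) (vertex-toℕ x)
    (∈-descent⁺ z≤n (≤-trans (<⇒≤pred (toℕ<n x)) (≤-reflexive (sym (+-identityʳ (pred n))))))

  -- The lift of g along vertex that starts at p, recorded by the interval [lo, hi] it sweeps.
  record Lift {u v : Fin n} (g : Walk Cₙ u v) (p : ℕ) : Set where
    field
      lo hi     : ℕ
      lo≤p      : lo ≤ p
      p≤hi      : p ≤ hi
      hi≤lo+len : hi ≤ lo + len g
      covers    : ∀ {x} → x ∈ verts g → ∃[ y ] lo ≤ y × y ≤ hi × vertex y ≡ x

  lift-∷ : ∀ {u v w p p'} (e : Cₙ u v) {g : Walk Cₙ v w} → vertex p ≡ u →
           p' ≤ suc p → p ≤ suc p' → Lift g p' → Lift (u ∷⟨ e ⟩ g) p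
  lift-∷ {u} {p = p} {p'} e {g} p↦u p'≤1+p p≤1+p' L = record
    { lo = lo ⊓ p
    ; hi = hi ⊔ p
    ; lo≤p = m⊓n≤n lo p
    ; p≤hi = m≤n⊔m hi p
    ; hi≤lo+len = ⊔-lub hi-bound p-bound
    ; covers = covers′
    }
    where
    open Lift L
    open ≤-Reasoning
    ≤lo⊓p+len : ∀ {z} → z ≤ lo + suc (len g) → z ≤ p + suc (len g) → z ≤ lo ⊓ p + suc (len g)
    ≤lo⊓p+len z≤ z≤′ = subst (_ ≤_) (sym (+-distribʳ-⊓ (suc (len g)) lo p)) (⊓-glb z≤ z≤′)
    hi-bound : hi ≤ lo ⊓ p + suc (len g)
    hi-bound = ≤lo⊓p+len (≤-trans hi≤lo+len (+-monoʳ-≤ lo (n≤1+n (len g)))) (begin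
      hi             ≤⟨ hi≤lo+len ⟩
      lo + len g     ≤⟨ +-monoˡ-≤ (len g) (≤-trans lo≤p p'≤1+p) ⟩
      suc p + len g  ≡⟨ +-suc p (len g) ⟨
      p + suc (len g) ∎)
    p-bound : p ≤ lo ⊓ p + suc (len g)
    p-bound = ≤lo⊓p+len (begin
      p                ≤⟨ p≤1+p' ⟩
      suc p'           ≤⟨ s≤s (≤-trans p≤hi hi≤lo+len) ⟩
      suc (lo + len g) ≡⟨ +-suc lo (len g) ⟨
      lo + suc (len g) ∎) (m≤m+n p (suc (len g)))
    covers′ : ∀ {x} → x ∈ ⁅ u ⁆ ∪ verts g → ∃[ y ] lo ⊓ p ≤ y × y ≤ hi ⊔ p × vertex y ≡ x
    covers′ x∈ with x∈p∪q⁻ ⁅ u ⁆ (verts g) x∈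
    ... | inj₁ x∈⁅u⁆ = p , m⊓n≤n lo p , m≤n⊔m hi p , trans p↦u (sym (x∈⁅y⁆⇒x≡y u x∈⁅u⁆))
    ... | inj₂ x∈g with covers x∈g
    ...   | y , lo≤y , y≤hi , y↦x = y , ≤-trans (m⊓n≤m lo p) lo≤y , ≤-trans y≤hi (m≤m⊔n hi p) , y↦x

  -- Starting at p ≥ len g keeps the lift inside ℕ.
  lift : ∀ {u v} (g : Walk Cₙ u v) (p : ℕ) → vertex p ≡ u → len g ≤ p → Lift g p
  lift [ v ] p p↦v _ = record
    { lo = p ; hi = p ; lo≤p = ≤-refl ; p≤hi = ≤-refl ; hi≤lo+len = m≤m+n p 0
    ; covers = λ x∈ → p , ≤-refl , ≤-refl , trans p↦v (sym (x∈⁅y⁆⇒x≡y v x∈)) }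
  lift (u ∷⟨ inj₁ e ⟩ g) p p↦u 1+len≤p =
    lift-∷ (inj₁ e) p↦u ≤-refl (m≤n⇒m≤1+n (n≤1+n p))
      (lift g (suc p) (lift-forward e p↦u) (m≤n⇒m≤1+n (<⇒≤ 1+len≤p)))
  lift (u ∷⟨ inj₂ e ⟩ g) (suc p) p+1↦u (s≤s len≤p) =
    lift-∷ (inj₂ e) p+1↦u (m≤n⇒m≤1+n (n≤1+n p)) ≤-refl
      (lift g p (lift-backward e p+1↦u) len≤p)

  verts⊆descent : ∀ {u v} (g : Walk Cₙ u v) → ∃[ b ] ∃[ w ] w ≤ len g × verts g ⊆ verts (descent b w)
  verts⊆descent {u} g = lo , hi ∸ lo , m≤n+o⇒m∸n≤o hi lo hi≤lo+len , within
    where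
    open Lift (lift g (len g * n + toℕ u) (trans (vertex-*n+ (len g) (toℕ u)) (vertex-toℕ u))
                    (≤-trans (m≤m*n (len g) n) (m≤m+n _ (toℕ u))))
    within : verts g ⊆ verts (descent lo (hi ∸ lo))
    within x∈ with covers x∈
    ... | y , lo≤y , y≤hi , y↦x = subst (_∈ _) y↦x
      (∈-descent⁺ lo≤y (≤-trans y≤hi (≤-reflexive (sym (m∸n+n≡m (≤-trans lo≤p p≤hi))))))

  descent-isGeodesic : ∀ b {d} → d + d ≤ n → IsGeodesic Cₙ (descent b d)
  descent-isGeodesic b {d} d+d≤n h = subst (_≤ len h) (sym (len-descent b d)) (≮⇒≥ no-shortcut)
    where
    no-shortcut : ¬ len h < d
    no-shortcut len<d with verts⊆descent h
    ... | lo , w , w≤len , h⊆arc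
        with ∈-descent⁻ (h⊆arc (source∈verts h)) | ∈-descent⁻ (h⊆arc (target∈verts h))
    ... | y₁ , lo≤y₁ , y₁≤w+lo , y₁↦d+b | y₂ , lo≤y₂ , y₂≤w+lo , y₂↦b = <⇒≱ far near
      where
      open ≤-Reasoning
      w<d : w < d
      w<d = ≤-<-trans w≤len len<d
      near : n + y₁ ≤ d + y₂
      near = vertex≡⇒n+x≤y (trans y₁↦d+b (vertex-+-cong d (sym y₂↦b))) (begin-strict
        y₁      ≤⟨ y₁≤w+lo ⟩
        w + lo  ≤⟨ +-monoʳ-≤ w lo≤y₂ ⟩
        w + y₂  <⟨ +-monoˡ-< y₂ w<d ⟩
        d + y₂  ∎)
      far : d + y₂ < n + y₁
      far = begin-strict
        d + y₂        ≤⟨ +-monoʳ-≤ d (≤-trans y₂≤w+lo (+-monoʳ-≤ w lo≤y₁)) ⟩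
        d + (w + y₁)  <⟨ +-monoʳ-< d (+-monoˡ-< y₁ w<d) ⟩
        d + (d + y₁)  ≡⟨ +-assoc d d y₁ ⟨
        d + d + y₁    ≤⟨ +-monoˡ-≤ y₁ d+d≤n ⟩
        n + y₁        ∎

  module Count (S : Subset n) where

    hits : ℕ → ℕ
    hits x = ∣ S ∩ ⁅ vertex x ⁆ ∣

    window : ℕ → ℕ → ℕ
    window b w = ∑[ j < w ] hits (toℕ j + b)

    window-suc : ∀ b w → window b (suc w) ≡ hits b + window (suc b) w
    window-suc b w = cong (hits b +_) (sum-cong-≗ {w} λ j → cong hits (sym (+-suc (toℕ j) b)))

    window-snoc : ∀ b w → window b (suc w) ≡ window b w + hits (w + b)
    window-snoc b zero = +-comm (hits b) 0
    window-snoc b (suc w) = begin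
      window b (suc (suc w))                          ≡⟨ window-suc b (suc w) ⟩
      hits b + window (suc b) (suc w)                 ≡⟨ cong (hits b +_) (window-snoc (suc b) w) ⟩
      hits b + (window (suc b) w + hits (w + suc b))  ≡⟨ +-assoc (hits b) _ _ ⟨
      hits b + window (suc b) w + hits (w + suc b)    ≡⟨ cong₂ _+_ (sym (window-suc b w)) (cong hits (+-suc w b)) ⟩
      window b (suc w) + hits (suc w + b)             ∎
      where open ≡-Reasoning

    window-periodic : ∀ b → window b n ≡ window 0 n
    window-periodic zero = refl
    window-periodic (suc b) = trans (+-cancelˡ-≡ (hits b) _ _ shift) (window-periodic b)
      where
      open ≡-Reasoning
      shift : hits b + window (suc b) n ≡ hits b + window b n
      shift = begin
        hits b + window (suc b) n  ≡⟨ window-suc b n ⟨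
        window b (suc n)           ≡⟨ window-snoc b n ⟩
        window b n + hits (n + b)  ≡⟨ cong (λ v → window b n + ∣ S ∩ ⁅ v ⁆ ∣) (vertex-n+ b) ⟩
        window b n + hits b        ≡⟨ +-comm (window b n) (hits b) ⟩
        hits b + window b n        ∎

    ∑-window : ∀ w → ∑[ b < n ] window (toℕ b) w ≡ w * window 0 n
    ∑-window w = begin
      ∑[ b < n ] ∑[ j < w ] hits (toℕ j + toℕ b)  ≡⟨ ∑-comm {n} {w} (λ b j → hits (toℕ j + toℕ b)) ⟩
      ∑[ j < w ] ∑[ b < n ] hits (toℕ j + toℕ b)  ≡⟨ sum-cong-≗ {w} (λ j → sum-cong-≗ {n} λ b → cong hits (+-comm (toℕ j) (toℕ b))) ⟩
      ∑[ j < w ] window (toℕ j) n                 ≡⟨ sum-cong-≗ {w} (λ j → window-periodic (toℕ j)) ⟩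
      ∑[ j < w ] window 0 n                       ≡⟨ ∑-replicate w (window 0 n) ⟩
      w * window 0 n                              ∎
      where open ≡-Reasoning

    ∣S∩descent∣ : ∀ b {w} → w < n → ∣ S ∩ verts (descent b w) ∣ ≡ window b (suc w)
    ∣S∩descent∣ b {zero} _ = sym (+-identityʳ (hits b))
    ∣S∩descent∣ b {suc w} 1+w<n = begin
      ∣ S ∩ (⁅ vertex (suc w + b) ⁆ ∪ verts (descent b w)) ∣
        ≡⟨ ∣r∩[⁅x⁆∪q]∣≡∣r∩⁅x⁆∣+∣r∩q∣ S (verts (descent b w)) (top∉descent 1+w<n) ⟩
      hits (suc w + b) + ∣ S ∩ verts (descent b w) ∣
        ≡⟨ cong (hits (suc w + b) +_) (∣S∩descent∣ b (<-trans (n<1+n w) 1+w<n)) ⟩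
      hits (suc w + b) + window b (suc w)
        ≡⟨ +-comm (hits (suc w + b)) _ ⟩
      window b (suc w) + hits (suc w + b)
        ≡⟨ window-snoc b (suc w) ⟨
      window b (suc (suc w))
        ∎
      where open ≡-Reasoning

    ∣S∣≡window : ∣ S ∣ ≡ window 0 n
    ∣S∣≡window = begin
      ∣ S ∣                               ≡⟨ cong ∣_∣ (∩-identityʳ S) ⟨
      ∣ S ∩ ⊤ ∣                           ≡⟨ cong (λ V → ∣ S ∩ V ∣) verts-descent≡⊤ ⟨
      ∣ S ∩ verts (descent 0 (pred n)) ∣  ≡⟨ ∣S∩descent∣ 0 (m≤pred[n]⇒suc[m]≤n ≤-refl) ⟩
      window 0 (suc (pred n))             ≡⟨ cong (window 0) (suc-pred n) ⟩
      window 0 n                          ∎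
      where open ≡-Reasoning

  isKGenDPos⇒∣S∣≤k*n/[1+d] : ∀ {k d} → d < n → d + d ≤ n → (S : Subset n) → IsKGenDPos Cₙ (suc k) d S →
             ∣ S ∣ ≤ k * n / suc d
  isKGenDPos⇒∣S∣≤k*n/[1+d] {k} {d} d<n d+d≤n S S-pos = m*n≤o⇒m≤o/n (suc d) (begin
    ∣ S ∣ * suc d                      ≡⟨ *-comm ∣ S ∣ (suc d) ⟩
    suc d * ∣ S ∣                      ≡⟨ cong (suc d *_) ∣S∣≡window ⟩
    suc d * window 0 n                 ≡⟨ ∑-window (suc d) ⟨
    ∑[ b < n ] window (toℕ b) (suc d)  ≤⟨ ∑-≤-* n _ (λ b → window≤k (toℕ b)) ⟩
    n * k                              ≡⟨ *-comm n k ⟩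
    k * n                              ∎)
    where
    open Count S
    open ≤-Reasoning
    window≤k : ∀ b → window b (suc d) ≤ k
    window≤k b = ≮⇒≥ λ k<window → <-irrefl (sym (len-descent b d))
      (S-pos _ _ (descent b d) (descent-isGeodesic b d+d≤n)
             (subst (k <_) (sym (∣S∩descent∣ b d<n)) k<window))

  module Balanced (m : ℕ) (m≤n : m ≤ n) where

    level : ℕ → ℕ
    level x = x * m / n

    balanced : Subset n
    balanced = tabulate λ i → level (toℕ i) <ᵇ level (suc (toℕ i))

    open Count balanced

    level-mono : ∀ {x y} → x ≤ y → level x ≤ level y
    level-mono x≤y = /-monoˡ-≤ n (*-monoˡ-≤ m x≤y)

    level-suc : ∀ x → level (suc x) ≤ suc (level x)
    level-suc x = begin
      (m + x * m) / n      ≤⟨ /-monoˡ-≤ n (+-monoˡ-≤ (x * m) m≤n) ⟩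
      (n + x * m) / n      ≡⟨ +-distrib-/-∣ˡ (x * m) ∣-refl ⟩
      n / n + x * m / n    ≡⟨ cong (_+ level x) (n/n≡1 n) ⟩
      suc (level x)        ∎
      where open ≤-Reasoning

    level-+*n : ∀ x q → level (x + q * n) ≡ level x + q * m
    level-+*n x q = begin
      (x + q * n) * m / n          ≡⟨ cong (_/ n) (*-distribʳ-+ m x (q * n)) ⟩
      (x * m + q * n * m) / n      ≡⟨ cong (λ t → (x * m + t) / n) (*-assoc q n m) ⟩
      (x * m + q * (n * m)) / n    ≡⟨ cong (λ t → (x * m + q * t) / n) (*-comm n m) ⟩
      (x * m + q * (m * n)) / n    ≡⟨ cong (λ t → (x * m + t) / n) (*-assoc q m n) ⟨
      (x * m + q * m * n) / n      ≡⟨ +-distrib-/-∣ʳ (x * m) (n∣m*n (q * m)) ⟩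
      level x + q * m * n / n      ≡⟨ cong (level x +_) (m*n/n≡m (q * m) n) ⟩
      level x + q * m              ∎
      where open ≡-Reasoning

    ∣balanced∩⁅i⁆∣+level : ∀ i → ∣ balanced ∩ ⁅ i ⁆ ∣ + level (toℕ i) ≡ level (suc (toℕ i))
    ∣balanced∩⁅i⁆∣+level i with level (toℕ i) <? level (suc (toℕ i))
    ... | yes jump = trans (cong (_+ level (toℕ i)) (x∈p⇒∣p∩⁅x⁆∣≡1 i∈balanced))
                           (≤-antisym jump (level-suc (toℕ i)))
      where
      i∈balanced : i ∈ balanced
      i∈balanced = ∈-tabulate⁺ (Equivalence.to T-≡ (<⇒<ᵇ jump))
    ... | no no-jump = trans (cong (_+ level (toℕ i)) (x∉p⇒∣p∩⁅x⁆∣≡0 i∉balanced))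
                             (≤-antisym (level-mono (n≤1+n (toℕ i))) (≮⇒≥ no-jump))
      where
      i∉balanced : i ∉ balanced
      i∉balanced i∈ = no-jump (<ᵇ⇒< _ _ (Equivalence.from T-≡ (∈-tabulate⁻ i∈)))

    hits+level : ∀ x → hits x + level x ≡ level (suc x)
    hits+level x = begin
      hits x + level x            ≡⟨ cong (λ y → hits x + level y) x≡ ⟩
      hits x + level (r + q * n)  ≡⟨ cong (hits x +_) (level-+*n r q) ⟩
      hits x + (level r + q * m)  ≡⟨ +-assoc (hits x) _ _ ⟨
      hits x + level r + q * m    ≡⟨ cong (_+ q * m) hits+level-r ⟩
      level (suc r) + q * m       ≡⟨ level-+*n (suc r) q ⟨
      level (suc r + q * n)       ≡⟨ cong (level ∘ suc) x≡ ⟨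
      level (suc x)               ∎
      where
      open ≡-Reasoning
      r = x % n
      q = x / n
      x≡ : x ≡ r + q * n
      x≡ = m≡m%n+[m/n]*n x n
      hits+level-r : hits x + level r ≡ level (suc r)
      hits+level-r = subst (λ t → hits x + level t ≡ level (suc t)) (toℕ-vertex x)
                           (∣balanced∩⁅i⁆∣+level (vertex x))

    window+level : ∀ b w → window b w + level b ≡ level (w + b)
    window+level b zero = refl
    window+level b (suc w) = begin
      window b (suc w) + level b             ≡⟨ cong (_+ level b) (window-suc b w) ⟩
      hits b + window (suc b) w + level b    ≡⟨ cong (_+ level b) (+-comm (hits b) _) ⟩
      window (suc b) w + hits b + level b    ≡⟨ +-assoc (window (suc b) w) _ _ ⟩
      window (suc b) w + (hits b + level b)  ≡⟨ cong (window (suc b) w +_) (hits+level b) ⟩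
      window (suc b) w + level (suc b)       ≡⟨ window+level (suc b) w ⟩
      level (w + suc b)                      ≡⟨ cong level (+-suc w b) ⟩
      level (suc w + b)                      ∎
      where open ≡-Reasoning

    ∣balanced∣ : ∣ balanced ∣ ≡ m
    ∣balanced∣ = begin
      ∣ balanced ∣             ≡⟨ ∣S∣≡window ⟩
      window 0 n               ≡⟨ +-identityʳ _ ⟨
      window 0 n + 0           ≡⟨ cong (window 0 n +_) (0/n≡0 n) ⟨
      window 0 n + level 0     ≡⟨ window+level 0 n ⟩
      level (n + 0)            ≡⟨ cong level (+-identityʳ n) ⟩
      n * m / n                ≡⟨ cong (_/ n) (*-comm n m) ⟩
      m * n / n                ≡⟨ m*n/n≡m m n ⟩
      m                        ∎
      where open ≡-Reasoning

    window≤ : ∀ {K d} → suc d * m ≤ K * n → ∀ b {w} → w ≤ suc d → window b w ≤ K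
    window≤ {K} {d} [1+d]m≤Kn b {w} w≤1+d = +-cancelʳ-≤ (level b) (window b w) K (begin
      window b w + level b  ≡⟨ window+level b w ⟩
      level (w + b)         ≤⟨ s≤s⁻¹ (m<n*o⇒m/o<n (begin-strict
        (w + b) * m                  ≡⟨ *-distribʳ-+ m w b ⟩
        w * m + b * m                ≤⟨ +-monoˡ-≤ (b * m) (≤-trans (*-monoˡ-≤ m w≤1+d) [1+d]m≤Kn) ⟩
        K * n + b * m                <⟨ +-monoʳ-< (K * n) bm<[1+level]n ⟩
        K * n + suc (level b) * n    ≡⟨ *-distribʳ-+ n K (suc (level b)) ⟨
        (K + suc (level b)) * n      ≡⟨ cong (_* n) (+-suc K (level b)) ⟩
        suc (K + level b) * n        ∎)) ⟩
      K + level b           ∎)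
      where
      open ≤-Reasoning
      bm<[1+level]n : b * m < suc (level b) * n
      bm<[1+level]n = begin-strict
        b * m                       ≡⟨ m≡m%n+[m/n]*n (b * m) n ⟩
        b * m % n + level b * n     <⟨ +-monoˡ-< (level b * n) (m%n<n (b * m) n) ⟩
        n + level b * n             ∎

    balanced-isKGenDPos : ∀ {k d} → d < n → suc d * m ≤ k * n → IsKGenDPos Cₙ (suc k) d balanced
    balanced-isKGenDPos {k} {d} d<n [1+d]m≤kn u v g _ k<∣balanced∩g∣ = ≰⇒> short-impossible
      where
      short-impossible : ¬ len g ≤ d
      short-impossible len≤d with verts⊆descent g
      ... | b , w , w≤len , g⊆arc = <⇒≱ k<∣balanced∩g∣ (begin
        ∣ balanced ∩ verts g ∣                 ≤⟨ p⊆q⇒∣p∣≤∣q∣ balanced∩g⊆arc ⟩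
        ∣ balanced ∩ verts (descent b w) ∣     ≡⟨ ∣S∩descent∣ b (≤-<-trans (≤-trans w≤len len≤d) d<n) ⟩
        window b (suc w)                       ≤⟨ window≤ [1+d]m≤kn b (s≤s (≤-trans w≤len len≤d)) ⟩
        k                                      ∎)
        where
        open ≤-Reasoning
        balanced∩g⊆arc : balanced ∩ verts g ⊆ balanced ∩ verts (descent b w)
        balanced∩g⊆arc x∈ with x∈p∩q⁻ balanced (verts g) x∈
        ... | x∈balanced , x∈g = x∈p∩q⁺ (x∈balanced , g⊆arc x∈g)

  balanced-isGpNumber : ∀ {k d} → 1 ≤ d → d + d ≤ n → k ≤ d → IsGpNumber Cₙ (suc k) d (k * n / suc d)
  balanced-isGpNumber {k} {d} 1≤d d+d≤n k≤d =
    (balanced , balanced-isKGenDPos d<n [1+d]m≤kn , ∣balanced∣) , isKGenDPos⇒∣S∣≤k*n/[1+d] d<n d+d≤n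
    where
    m = k * n / suc d
    d<n : d < n
    d<n = ≤-trans (≤-reflexive (+-comm 1 d)) (≤-trans (+-monoʳ-≤ d 1≤d) d+d≤n)
    m≤n : m ≤ n
    m≤n = ≤-trans (/-monoˡ-≤ (suc d) (*-monoˡ-≤ n (m≤n⇒m≤1+n k≤d)))
                  (≤-reflexive (trans (cong (_/ suc d) (*-comm (suc d) n)) (m*n/n≡m n (suc d))))
    [1+d]m≤kn : suc d * m ≤ k * n
    [1+d]m≤kn = subst (_≤ k * n) (*-comm m (suc d)) (m/n*n≤m (k * n) (suc d))
    open Balanced m m≤n

m≤n/2⇒m+m≤n : ∀ {m n} → m ≤ n / 2 → m + m ≤ n
m≤n/2⇒m+m≤n {m} {n} m≤n/2 = begin
  m + m      ≡⟨ cong (m +_) (+-identityʳ m) ⟨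
  2 * m      ≡⟨ *-comm 2 m ⟩
  m * 2      ≤⟨ *-monoˡ-≤ 2 m≤n/2 ⟩
  n / 2 * 2  ≤⟨ m/n*n≤m n 2 ⟩
  n          ∎
  where open ≤-Reasoning

theorem4p6 : (n d k : ℕ) .{{_ : NonZero n}} →
    1 ≤ d → d ≤ n / 2 → 2 ≤ k → k ≤ n / 2 + 1 →
    (d ≤ k ∸ 2 → IsGpNumber (CycleAdj n) k d n)
    × (k ∸ 1 ≤ d → IsGpNumber (CycleAdj n) k d (((k ∸ 1) * n) / suc d))
theorem4p6 n d k 1≤d d≤n/2 (s≤s (s≤s z≤n)) _ =
  ⊤-isGpNumber (CycleAdj n) , Cycle.balanced-isGpNumber n 1≤d (m≤n/2⇒m+m≤n d≤n/2)
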